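{- Let $f$ be a partial $2$-tone edge $9$-coloring of a cubic graph $G$. Let $u\in V(G)$ have neighbors $u_1,u_2,u_3$ such that $u_2$ is adjacent to both $u_1$ and $u_3$. If the edges $uu_1$, $uu_2$, $uu_3$ are uncolored, then $f$ can be extended to these three edges.
   Context: All graphs are simple and finite; cubic means every vertex has degree $3$. The distance $d_G(e,e')$ between edges is the distance between the corresponding vertices in the line graph $L(G)$. A partial $2$-tone edge $k$-coloring of $G$ is a map $f:E'\to\binom{\{1,\dots,k\}}{2}$ for some $E'\subseteq E(G)$ such that for all distinct $e,e'\in E'$, $|f(e)\cap f(e')|<d_G(e,e')$; edges outside $E'$ are uncolored. Extending $f$ to a set of edges means assigning labels to them so that the result is again a partial $2$-tone edge $k$-coloring. -}

module Defs where

open import Data.Nat using (ℕ; zero; suc; _<_)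
open import Data.Fin using (Fin)
open import Data.Bool using (Bool; T)
open import Data.Maybe using (Maybe; just; nothing)
open import Data.Product using (Σ; _×_; _,_)
open import Data.Sum using (_⊎_)
open import Data.Vec using (tabulate)
open import Data.Fin.Subset using (Subset; ∣_∣; _∩_)
open import Relation.Nullary using (¬_)
open import Relation.Binary.PropositionalEquality using (_≡_)

record Graph (n : ℕ) : Set where
  field
    adj    : Fin n → Fin n → Bool
    sym    : ∀ u v → adj u v ≡ adj v u
    irrefl : ∀ u → adj u u ≡ Data.Bool.false

open Graph public

module _ {n : ℕ} (G : Graph n) where

  Adj : Fin n → Fin n → Set
  Adj u v = T (adj G u v)

  N : Fin n → Subset n
  N v = tabulate (λ w → adj G v w)

  deg : Fin n → ℕ
  deg v = ∣ N v ∣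

  Cubic : Set
  Cubic = ∀ v → deg v ≡ 3

-- Edges are written as ordered pairs (a , b) of adjacent vertices; the
-- pairs (a , b) and (b , a) denote the same (unordered) edge.
SameEdge : {n : ℕ} → Fin n → Fin n → Fin n → Fin n → Set
SameEdge a b c d = (a ≡ c × b ≡ d) ⊎ (a ≡ d × b ≡ c)

ShareEnd : {n : ℕ} → Fin n → Fin n → Fin n → Fin n → Set
ShareEnd a b c d = (a ≡ c ⊎ a ≡ d) ⊎ (b ≡ c ⊎ b ≡ d)

module _ {n : ℕ} (G : Graph n) where

  LAdj : Fin n → Fin n → Fin n → Fin n → Set
  LAdj a b c d = Adj G a b × Adj G c d × ¬ SameEdge a b c d × ShareEnd a b c d

  data LWalk : Fin n → Fin n → Fin n → Fin n → ℕ → Set where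
    here : ∀ {a b c d} → Adj G a b → SameEdge a b c d → LWalk a b c d 0
    step : ∀ {a b x y c d k} → LAdj a b x y → LWalk x y c d k →
           LWalk a b c d (suc k)

Label : ℕ → Set
Label k = Σ (Subset k) (λ s → ∣ s ∣ ≡ 2)

common : {k : ℕ} → Label k → Label k → ℕ
common (s , _) (t , _) = ∣ s ∩ t ∣

-- IsPartial2Tone G k f : f is a partial 2-tone edge k-colouring of G, where
-- E' = { ab edge : f a b ≢ nothing }.  The condition
-- |f(e) ∩ f(e')| < d(e,e') is unfolded as: for every walk in L(G) from e to
-- e' of length m, |f(e) ∩ f(e')| < m  (d = minimum such m, ∞ if none).
record IsPartial2Tone {n : ℕ} (G : Graph n) (k : ℕ)
                      (f : Fin n → Fin n → Maybe (Label k)) : Set where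
  field
    onEdges : ∀ a b A → f a b ≡ just A → Adj G a b
    symm    : ∀ a b → f a b ≡ f b a
    valid   : ∀ a b c d A B → f a b ≡ just A → f c d ≡ just B →
              ¬ SameEdge a b c d →
              ∀ m → LWalk G a b c d m → common A B < m

Extends3 : {n : ℕ} (G : Graph n) (k : ℕ)
           (f g : Fin n → Fin n → Maybe (Label k)) (u u₁ u₂ u₃ : Fin n) → Set
Extends3 G k f g u u₁ u₂ u₃ =
  IsPartial2Tone G k g
  × (∀ x y → ¬ SameEdge x y u u₁ → ¬ SameEdge x y u u₂ → ¬ SameEdge x y u u₃ →
       g x y ≡ f x y)
  × (Σ (Label k) λ A → g u u₁ ≡ just A)
  × (Σ (Label k) λ A → g u u₂ ≡ just A)
  × (Σ (Label k) λ A → g u u₃ ≡ just A)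

{-# OPTIONS --safe #-}

-- Colour uu₁, uu₂, uu₃ one at a time.  A label for an uncoloured edge is safe as soon
-- as it is disjoint from the labels of the coloured edges meeting it and shares at most
-- one colour with those at distance two; farther away nothing can fail, since two labels
-- share at most two colours.  Let P, Q be the labels of u₂u₁, u₂u₃ and R, S those of
-- u₁x, u₃y, where x and y are the third neighbours of u₁ and u₃.  We give uu₁ the label
-- {q,a}, uu₃ the label {p,b} and uu₂ the label {c,e}.  As u₂u₃ is at distance two from
-- uu₁ and |Q ∩ R| ≤ 1, q can be taken among the colours of Q when u₂u₃ is coloured, and
-- likewise p among those of P.  Then q and p cost nothing beyond the at most two colours
-- of Q ∪ {q} and of P ∪ {p}, which a, b, c, e avoid anyway, and each of a, b, c, e has
-- at most eight forbidden values.  At a vertex at distance two, the second colour of a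
-- label only has to avoid the partners of its first colour there, and there is at most
-- one such partner because the labels at a vertex are disjoint.

module Submission where

open import Defs hiding (sym)
open import Data.Bool using (T)
open import Data.Bool.Properties using (T-≡)
open import Data.Empty using (⊥-elim)
open import Data.Fin using (Fin; zero; suc; _≟_)
open import Data.Fin.Properties using (any?)
open import Data.Fin.Subset
  using (Subset; _∈_; _∉_; _∩_; _∪_; _-_; ⁅_⁆; ⋃; ∣_∣; outside; inside)
  renaming (⊥ to ∅; ⊤ to full)
open import Data.Fin.Subset.Properties
open import Data.List using (List; []; _∷_; length; foldr)
open import Data.Vec using ([]; _∷_; here; there)
open import Data.Vec.Properties using (lookup⇒[]=; []=⇒lookup; lookup∘tabulate)
open import Data.List.Relation.Unary.All as List using ([]; _∷_)
open import Data.List.Relation.Unary.AllPairs.Core using ([]; _∷_)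
open import Data.List.Relation.Unary.Unique.Propositional using (Unique)
open import Data.List.Relation.Binary.Pointwise.Base using (Pointwise; []; _∷_)
open import Data.Maybe using (Maybe; just; nothing)
open import Data.Maybe.Properties using (just-injective)
open import Data.Maybe.Relation.Unary.All using (All; just; nothing; drop-just)
open import Data.Nat.ListAction using (sum)
open import Data.Nat using (ℕ; zero; suc; _+_; _≤_; _<_; z≤n; s≤s)
open import Data.Nat.Properties
  using ( ≤-refl; ≤-reflexive; ≤-trans; ≤-antisym; <⇒≤; ≤-pred; +-mono-≤; +-monoʳ-≤; +-suc
        ; m≤m+n; m≤n+m; <-irrefl; <-≤-trans; ≤-<-trans; n≤1+n)
open import Data.Product using (Σ; ∃; ∃₂; _×_; _,_; proj₂)
open import Data.Sum using (_⊎_; inj₁; inj₂; [_,_]′)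
import Data.Sum as Sum
open import Data.Unit using (⊤; tt)
open import Function using (_∘_)
open import Function.Bundles using (Equivalence)
open import Relation.Nullary using (¬_; Dec; yes; no)
open import Relation.Nullary.Decidable using (_×-dec_; _⊎-dec_)
open import Relation.Binary.PropositionalEquality
  using (_≡_; _≢_; refl; sym; trans; cong; cong₂; subst; subst₂; ≢-sym)

private
  variable
    n k m : ℕ
    a b c d v w : Fin n

-- Sets of colours

∣p∪q∣≤∣p∣+∣q∣ : (p q : Subset k) → ∣ p ∪ q ∣ ≤ ∣ p ∣ + ∣ q ∣
∣p∪q∣≤∣p∣+∣q∣ [] [] = z≤n
∣p∪q∣≤∣p∣+∣q∣ (inside ∷ p) (s ∷ q) =
  s≤s (≤-trans (∣p∪q∣≤∣p∣+∣q∣ p q) (+-monoʳ-≤ ∣ p ∣ (∣p∣≤∣x∷p∣ s q)))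
∣p∪q∣≤∣p∣+∣q∣ (outside ∷ p) (inside ∷ q) =
  subst (suc ∣ p ∪ q ∣ ≤_) (sym (+-suc ∣ p ∣ ∣ q ∣)) (s≤s (∣p∪q∣≤∣p∣+∣q∣ p q))
∣p∪q∣≤∣p∣+∣q∣ (outside ∷ p) (outside ∷ q) = ∣p∪q∣≤∣p∣+∣q∣ p q

∣⋃ps∣≤sum : {ps : List (Subset k)} {bs : List ℕ} →
            Pointwise (λ p b → ∣ p ∣ ≤ b) ps bs → ∣ ⋃ ps ∣ ≤ sum bs
∣⋃ps∣≤sum {k = k} [] = ≤-reflexive (∣⊥∣≡0 k)
∣⋃ps∣≤sum {ps = p ∷ ps} (p≤b ∷ bounds) =
  ≤-trans (∣p∪q∣≤∣p∣+∣q∣ p (⋃ ps)) (+-mono-≤ p≤b (∣⋃ps∣≤sum bounds))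

∃-∈∷-∉∷ : ∀ {s t} {p q : Subset k} →
          ∃ (λ x → x ∈ p × x ∉ q) → ∃ λ x → x ∈ s ∷ p × x ∉ t ∷ q
∃-∈∷-∉∷ (x , x∈p , x∉q) = suc x , there x∈p , x∉q ∘ drop-there

∣q∣<∣p∣⇒∃∈p∉q : {p q : Subset k} → ∣ q ∣ < ∣ p ∣ → ∃ λ x → x ∈ p × x ∉ q
∣q∣<∣p∣⇒∃∈p∉q {p = []} {[]} ()
∣q∣<∣p∣⇒∃∈p∉q {p = inside ∷ p} {outside ∷ q} _ = zero , here , λ ()
∣q∣<∣p∣⇒∃∈p∉q {p = inside ∷ p} {inside ∷ q} (s≤s q<p) = ∃-∈∷-∉∷ (∣q∣<∣p∣⇒∃∈p∉q q<p)
∣q∣<∣p∣⇒∃∈p∉q {p = outside ∷ p} {outside ∷ q} q<p = ∃-∈∷-∉∷ (∣q∣<∣p∣⇒∃∈p∉q q<p)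
∣q∣<∣p∣⇒∃∈p∉q {p = outside ∷ p} {inside ∷ q} q<p = ∃-∈∷-∉∷ (∣q∣<∣p∣⇒∃∈p∉q (<⇒≤ q<p))

unique⊆⇒length≤∣p∣ : {xs : List (Fin k)} {p : Subset k} →
                     Unique xs → List.All (_∈ p) xs → length xs ≤ ∣ p ∣
unique⊆⇒length≤∣p∣ [] [] = z≤n
unique⊆⇒length≤∣p∣ {xs = x ∷ xs} {p} (x≢xs ∷ unique) (x∈p ∷ xs⊆p) =
  ≤-trans (s≤s (unique⊆⇒length≤∣p∣ unique xs⊆p-x)) (x∈p⇒∣p-x∣<∣p∣ x∈p)
  where
  xs⊆p-x : List.All (_∈ p - x) xs
  xs⊆p-x = List.zipWith (λ (x≢y , y∈p) → x∈p∧x≢y⇒x∈p-y y∈p (≢-sym x≢y)) (x≢xs , xs⊆p)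

x∈p⇒0<∣p∣ : {x : Fin k} {p : Subset k} → x ∈ p → 0 < ∣ p ∣
x∈p⇒0<∣p∣ x∈p = unique⊆⇒length≤∣p∣ ([] ∷ []) (x∈p ∷ [])

Avoids : Fin k → List (Subset k) → Set
Avoids x = foldr (λ p rest → x ∉ p × rest) ⊤

∉⋃⇒Avoids : {x : Fin k} (ps : List (Subset k)) → x ∉ ⋃ ps → Avoids x ps
∉⋃⇒Avoids [] _ = tt
∉⋃⇒Avoids (p ∷ ps) x∉ = x∉ ∘ x∈p∪q⁺ ∘ inj₁ , ∉⋃⇒Avoids ps (x∉ ∘ x∈p∪q⁺ ∘ inj₂)

fresh : (ps : List (Subset k)) {bs : List ℕ} →
        Pointwise (λ p b → ∣ p ∣ ≤ b) ps bs → sum bs < k → ∃ λ x → Avoids x ps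
fresh {k = k} ps {bs} bounds room =
  let x , _ , x∉⋃ps = ∣q∣<∣p∣⇒∃∈p∉q {p = full} {q = ⋃ ps}
                        (≤-<-trans (∣⋃ps∣≤sum bounds) (subst (sum bs <_) (sym (∣⊤∣≡n k)) room))
  in x , ∉⋃⇒Avoids ps x∉⋃ps

∈⁅x⁆∪⁅y⁆⇒ : {x y z : Fin k} → z ∈ ⁅ x ⁆ ∪ ⁅ y ⁆ → z ≡ x ⊎ z ≡ y
∈⁅x⁆∪⁅y⁆⇒ z∈ = Sum.map (x∈⁅y⁆⇒x≡y _) (x∈⁅y⁆⇒x≡y _) (x∈p∪q⁻ _ _ z∈)

∉⁅x⁆∪⁅y⁆ : {x y z : Fin k} → z ≢ x → z ≢ y → z ∉ ⁅ x ⁆ ∪ ⁅ y ⁆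
∉⁅x⁆∪⁅y⁆ z≢x z≢y = [ z≢x , z≢y ]′ ∘ ∈⁅x⁆∪⁅y⁆⇒

∈∉⇒≢ : {x y : Fin k} {p : Subset k} → x ∈ p → y ∉ p → x ≢ y
∈∉⇒≢ x∈p y∉p refl = y∉p x∈p

x∈p∧z∉p∧z∉⁅y⁆⇒z∉⁅x⁆∪⁅y⁆ : {x y z : Fin k} {p : Subset k} → x ∈ p → z ∉ p → z ∉ ⁅ y ⁆ →
                         z ∉ ⁅ x ⁆ ∪ ⁅ y ⁆
x∈p∧z∉p∧z∉⁅y⁆⇒z∉⁅x⁆∪⁅y⁆ x∈p z∉p z∉⁅y⁆ = ∉⁅x⁆∪⁅y⁆ (≢-sym (∈∉⇒≢ x∈p z∉p)) (x∉⁅y⁆⇒x≢y z∉⁅y⁆)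

∣⁅x⁆∣≤1 : (x : Fin k) → ∣ ⁅ x ⁆ ∣ ≤ 1
∣⁅x⁆∣≤1 x = ≤-reflexive (∣⁅x⁆∣≡1 x)

x∈⁅x⁆∪⁅y⁆ : (x y : Fin k) → x ∈ ⁅ x ⁆ ∪ ⁅ y ⁆
x∈⁅x⁆∪⁅y⁆ x y = x∈p∪q⁺ {p = ⁅ x ⁆} {q = ⁅ y ⁆} (inj₁ (x∈⁅x⁆ x))

y∈⁅x⁆∪⁅y⁆ : (x y : Fin k) → y ∈ ⁅ x ⁆ ∪ ⁅ y ⁆
y∈⁅x⁆∪⁅y⁆ x y = x∈p∪q⁺ {p = ⁅ x ⁆} {q = ⁅ y ⁆} (inj₂ (x∈⁅x⁆ y))

∣⁅x⁆∪⁅y⁆∣≡2 : {x y : Fin k} → x ≢ y → ∣ ⁅ x ⁆ ∪ ⁅ y ⁆ ∣ ≡ 2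
∣⁅x⁆∪⁅y⁆∣≡2 {x = x} {y} x≢y = ≤-antisym
  (≤-trans (∣p∪q∣≤∣p∣+∣q∣ ⁅ x ⁆ ⁅ y ⁆) (≤-reflexive (cong₂ _+_ (∣⁅x⁆∣≡1 x) (∣⁅x⁆∣≡1 y))))
  (unique⊆⇒length≤∣p∣ ((x≢y ∷ []) ∷ [] ∷ [])
                      (x∈⁅x⁆∪⁅y⁆ x y ∷ y∈⁅x⁆∪⁅y⁆ x y ∷ []))

pair : (x y : Fin k) → x ≢ y → Label k
pair x y x≢y = ⁅ x ⁆ ∪ ⁅ y ⁆ , ∣⁅x⁆∪⁅y⁆∣≡2 x≢y

∣⁅x⁆∪⁅y⁆∩q∣≡0 : {x y : Fin k} {q : Subset k} → x ∉ q → y ∉ q → ∣ (⁅ x ⁆ ∪ ⁅ y ⁆) ∩ q ∣ ≡ 0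
∣⁅x⁆∪⁅y⁆∩q∣≡0 {k = k} {x} {y} {q} x∉q y∉q = trans (cong ∣_∣ (Empty-unique empty)) (∣⊥∣≡0 k)
  where
  empty : ¬ ∃ λ z → z ∈ (⁅ x ⁆ ∪ ⁅ y ⁆) ∩ q
  empty (z , z∈) with x∈p∩q⁻ _ q z∈
  ... | z∈pair , z∈q with ∈⁅x⁆∪⁅y⁆⇒ z∈pair
  ...   | inj₁ refl = x∉q z∈q
  ...   | inj₂ refl = y∉q z∈q

x∉q⇒∣p∩q∣<∣p∣ : {x : Fin k} {p q : Subset k} → x ∈ p → x ∉ q → ∣ p ∩ q ∣ < ∣ p ∣
x∉q⇒∣p∩q∣<∣p∣ {x = x} {p} {q} x∈p x∉q =
  p⊂q⇒∣p∣<∣q∣ (p∩q⊆p p q , x , x∈p , x∉q ∘ proj₂ ∘ x∈p∩q⁻ p q)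

common≤2 : (A B : Label k) → common A B ≤ 2
common≤2 (A , ∣A∣≡2) (B , _) = ≤-trans (∣p∩q∣≤∣p∣ A B) (≤-reflexive ∣A∣≡2)

common-comm : (A B : Label k) → common A B ≡ common B A
common-comm (A , _) (B , _) = cong ∣_∣ (∩-comm A B)

colours : Maybe (Label k) → Subset k
colours nothing = ∅
colours (just (B , _)) = B

coloursOr : Maybe (Label k) → Fin k → Subset k
coloursOr nothing x = ⁅ x ⁆
coloursOr (just (B , _)) _ = B

∣colours∣≤2 : (M : Maybe (Label k)) → ∣ colours M ∣ ≤ 2
∣colours∣≤2 {k = k} nothing = ≤-trans (≤-reflexive (∣⊥∣≡0 k)) z≤n
∣colours∣≤2 (just (_ , ∣B∣≡2)) = ≤-reflexive ∣B∣≡2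

∣coloursOr∣≤2 : (M : Maybe (Label k)) (x : Fin k) → ∣ coloursOr M x ∣ ≤ 2
∣coloursOr∣≤2 nothing x = ≤-trans (≤-reflexive (∣⁅x⁆∣≡1 x)) (n≤1+n 1)
∣coloursOr∣≤2 (just (_ , ∣B∣≡2)) _ = ≤-reflexive ∣B∣≡2

∉coloursOr⇒∉colours : {M : Maybe (Label k)} {x y : Fin k} → y ∉ coloursOr M x → y ∉ colours M
∉coloursOr⇒∉colours {M = nothing} _ = ∉⊥
∉coloursOr⇒∉colours {M = just _} y∉ = y∉

Compatible : ℕ → Label k → Label k → Set
Compatible m L B = common L B < m

compatible₁ : {x y : Fin k} (x≢y : x ≢ y) {M : Maybe (Label k)} →
              x ∉ colours M → y ∉ colours M → All (Compatible 1 (pair x y x≢y)) M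
compatible₁ _ {nothing} _ _ = nothing
compatible₁ _ {just _} x∉ y∉ = just (s≤s (≤-reflexive (∣⁅x⁆∪⁅y⁆∩q∣≡0 x∉ y∉)))

compatible₂ : {x y : Fin k} (x≢y : x ≢ y) {M : Maybe (Label k)} →
              x ∉ colours M ⊎ y ∉ colours M → All (Compatible 2 (pair x y x≢y)) M
compatible₂ _ {nothing} _ = nothing
compatible₂ {x = x} {y} x≢y {just (B , _)} x∉⊎y∉ =
  just (<-≤-trans (misses-one x∉⊎y∉) (≤-reflexive (∣⁅x⁆∪⁅y⁆∣≡2 x≢y)))
  where
  misses-one : x ∉ B ⊎ y ∉ B → ∣ (⁅ x ⁆ ∪ ⁅ y ⁆) ∩ B ∣ < ∣ ⁅ x ⁆ ∪ ⁅ y ⁆ ∣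
  misses-one = [ x∉q⇒∣p∩q∣<∣p∣ (x∈⁅x⁆∪⁅y⁆ x y) , x∉q⇒∣p∩q∣<∣p∣ (y∈⁅x⁆∪⁅y⁆ x y) ]′

anchor : (M : Maybe (Label k)) (F : Subset k) (ps : List (Subset k)) {bs : List ℕ} →
         ∣ colours M ∩ F ∣ ≤ 1 → (∀ {x} → x ∈ colours M → Avoids x ps) →
         Pointwise (λ p b → ∣ p ∣ ≤ b) (F ∷ ps) bs → sum bs < k →
         ∃ λ x → x ∈ coloursOr M x × Avoids x (F ∷ ps)
anchor nothing F ps _ _ bounds room =
  let x , avoids = fresh (F ∷ ps) bounds room in x , x∈⁅x⁆ x , avoids
anchor (just (B , ∣B∣≡2)) F ps ∣B∩F∣≤1 B-avoids _ _ =
  let x , x∈B , x∉B∩F = ∣q∣<∣p∣⇒∃∈p∉q {p = B} {q = B ∩ F}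
                          (<-≤-trans (s≤s ∣B∩F∣≤1) (≤-reflexive (sym ∣B∣≡2)))
  in x , x∈B , x∉B∩F ∘ x∈p∩q⁺ ∘ (x∈B ,_) , B-avoids x∈B

-- Graphs and walks in the line graph

SameEdge-refl : SameEdge a b a b
SameEdge-refl = inj₁ (refl , refl)

SameEdge-sym : SameEdge a b c d → SameEdge c d a b
SameEdge-sym (inj₁ (refl , refl)) = inj₁ (refl , refl)
SameEdge-sym (inj₂ (refl , refl)) = inj₂ (refl , refl)

SameEdge-swap : SameEdge a b c d → SameEdge b a c d
SameEdge-swap (inj₁ (refl , refl)) = inj₂ (refl , refl)
SameEdge-swap (inj₂ (refl , refl)) = inj₁ (refl , refl)

SameEdge-trans : SameEdge a b c d → SameEdge c d v w → SameEdge a b v w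
SameEdge-trans (inj₁ (refl , refl)) cd≈vw = cd≈vw
SameEdge-trans (inj₂ (refl , refl)) cd≈vw = SameEdge-swap cd≈vw

SameEdge? : (a b c d : Fin n) → Dec (SameEdge a b c d)
SameEdge? a b c d = (a ≟ c ×-dec b ≟ d) ⊎-dec (a ≟ d ×-dec b ≟ c)

ShareEnd-sym : ShareEnd a b c d → ShareEnd c d a b
ShareEnd-sym (inj₁ (inj₁ refl)) = inj₁ (inj₁ refl)
ShareEnd-sym (inj₁ (inj₂ refl)) = inj₂ (inj₁ refl)
ShareEnd-sym (inj₂ (inj₁ refl)) = inj₁ (inj₂ refl)
ShareEnd-sym (inj₂ (inj₂ refl)) = inj₂ (inj₂ refl)

ShareEnd-respʳ : SameEdge v w c d → ShareEnd a b v w → ShareEnd a b c d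
ShareEnd-respʳ (inj₁ (refl , refl)) ab∩vw = ab∩vw
ShareEnd-respʳ (inj₂ (refl , refl)) ab∩vw = Sum.map Sum.swap Sum.swap ab∩vw

module GraphProperties {n : ℕ} (G : Graph n) where

  Adj-sym : Adj G a b → Adj G b a
  Adj-sym {a = a} {b = b} = subst T (Graph.sym G a b)

  Adj⇒≢ : Adj G a b → a ≢ b
  Adj⇒≢ {a = a} ab refl = subst T (irrefl G a) ab

  Adj⇒∈N : Adj G v w → w ∈ N G v
  Adj⇒∈N {v = v} {w = w} vw =
    lookup⇒[]= w (N G v) (trans (lookup∘tabulate (adj G v) w) (Equivalence.to T-≡ vw))

  ∈N⇒Adj : w ∈ N G v → Adj G v w
  ∈N⇒Adj {w = w} {v = v} w∈N =
    Equivalence.from T-≡ (trans (sym (lookup∘tabulate (adj G v) w)) ([]=⇒lookup w∈N))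

  NeighboursAre : Fin n → Fin n → Fin n → Fin n → Set
  NeighboursAre v a b c = ∀ {w} → Adj G v w → w ≡ a ⊎ w ≡ b ⊎ w ≡ c

  ∀-neighbour : {P : Fin n → Set} → NeighboursAre v a b c → P a → P b → P c →
                ∀ w → Adj G v w → P w
  ∀-neighbour neighbours pa pb pc _ vw with neighbours vw
  ... | inj₁ refl = pa
  ... | inj₂ (inj₁ refl) = pb
  ... | inj₂ (inj₂ refl) = pc

  cubic-neighbours : deg G v ≡ 3 → Adj G v a → Adj G v b → Adj G v c →
                     a ≢ b → a ≢ c → b ≢ c → NeighboursAre v a b c
  cubic-neighbours {v = v} {a = a} {b = b} {c = c} deg≡3 va vb vc a≢b a≢c b≢c {w} vw
    with w ≟ a | w ≟ b | w ≟ c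
  ... | yes w≡a | _ | _ = inj₁ w≡a
  ... | no _ | yes w≡b | _ = inj₂ (inj₁ w≡b)
  ... | no _ | no _ | yes w≡c = inj₂ (inj₂ w≡c)
  ... | no w≢a | no w≢b | no w≢c = ⊥-elim (<-irrefl refl (≤-trans four≤deg (≤-reflexive deg≡3)))
    where
    four≤deg : 4 ≤ deg G v
    four≤deg = unique⊆⇒length≤∣p∣ ((w≢a ∷ w≢b ∷ w≢c ∷ []) ∷ (a≢b ∷ a≢c ∷ []) ∷ (b≢c ∷ []) ∷ [] ∷ [])
                                  (Adj⇒∈N vw ∷ Adj⇒∈N va ∷ Adj⇒∈N vb ∷ Adj⇒∈N vc ∷ [])

  cubic-third-neighbour : deg G v ≡ 3 → Adj G v a → Adj G v b → a ≢ b →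
                          ∃ λ c → Adj G v c × c ≢ a × c ≢ b × NeighboursAre v a b c
  cubic-third-neighbour {v = v} {a = a} {b = b} deg≡3 va vb a≢b =
    let c , c∈N , c∉ab = ∣q∣<∣p∣⇒∃∈p∉q {p = N G v} {q = ⁅ a ⁆ ∪ ⁅ b ⁆}
                           (subst₂ _<_ (sym (∣⁅x⁆∪⁅y⁆∣≡2 a≢b)) (sym deg≡3) ≤-refl)
        c≢a : c ≢ a
        c≢a = λ c≡a → c∉ab (subst (_∈ ⁅ a ⁆ ∪ ⁅ b ⁆) (sym c≡a) (x∈⁅x⁆∪⁅y⁆ a b))
        c≢b : c ≢ b
        c≢b = λ c≡b → c∉ab (subst (_∈ ⁅ a ⁆ ∪ ⁅ b ⁆) (sym c≡b) (y∈⁅x⁆∪⁅y⁆ a b))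
    in c , ∈N⇒Adj c∈N , c≢a , c≢b
         , cubic-neighbours deg≡3 va vb (∈N⇒Adj c∈N) a≢b (≢-sym c≢a) (≢-sym c≢b)

  ¬SameEdge-at : Adj G a c → b ≢ c → ¬ SameEdge a b a c
  ¬SameEdge-at _ b≢c (inj₁ (_ , b≡c)) = b≢c b≡c
  ¬SameEdge-at ac _ (inj₂ (a≡c , _)) = Adj⇒≢ ac a≡c

  Adj-resp : SameEdge a b c d → Adj G c d → Adj G a b
  Adj-resp (inj₁ (refl , refl)) cd = cd
  Adj-resp (inj₂ (refl , refl)) cd = Adj-sym cd

  LAdj-sym : LAdj G a b c d → LAdj G c d a b
  LAdj-sym (ab , cd , ab≉cd , ab∩cd) = cd , ab , ab≉cd ∘ SameEdge-sym , ShareEnd-sym ab∩cd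

  LAdj-resp : SameEdge a b c d → LAdj G c d v w → LAdj G a b v w
  LAdj-resp (inj₁ (refl , refl)) adj = adj
  LAdj-resp (inj₂ (refl , refl)) (cd , vw , cd≉vw , cd∩vw) =
    Adj-sym cd , vw , cd≉vw ∘ SameEdge-swap , Sum.swap cd∩vw

  LWalk-resp : SameEdge a b c d → LWalk G c d v w m → LWalk G a b v w m
  LWalk-resp ab≈cd (here cd cd≈vw) = here (Adj-resp ab≈cd cd) (SameEdge-trans ab≈cd cd≈vw)
  LWalk-resp ab≈cd (step adj walk) = step (LAdj-resp ab≈cd adj) walk

  LWalk-snoc : LWalk G a b c d m → LAdj G c d v w → LWalk G a b v w (suc m)
  LWalk-snoc (here _ ab≈cd) adj@(_ , vw , _) = step (LAdj-resp ab≈cd adj) (here vw SameEdge-refl)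
  LWalk-snoc (step adj walk) adj′ = step adj (LWalk-snoc walk adj′)

  LWalk-reverse : LWalk G a b c d m → LWalk G c d a b m
  LWalk-reverse (here ab ab≈cd) = here (Adj-resp (SameEdge-sym ab≈cd) ab) (SameEdge-sym ab≈cd)
  LWalk-reverse (step adj walk) = LWalk-snoc (LWalk-reverse walk) (LAdj-sym adj)

  LWalk₀⇒SameEdge : LWalk G a b c d 0 → SameEdge a b c d
  LWalk₀⇒SameEdge (here _ ab≈cd) = ab≈cd

  LWalk₁⇒ShareEnd : LWalk G a b c d 1 → ShareEnd a b c d
  LWalk₁⇒ShareEnd (step (_ , _ , _ , ab∩vw) (here _ vw≈cd)) = ShareEnd-respʳ vw≈cd ab∩vw

  LWalk₂⇒ShareEnd² : LWalk G a b c d 2 →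
                     ∃₂ λ h₁ h₂ → Adj G h₁ h₂ × ShareEnd a b h₁ h₂ × ShareEnd h₁ h₂ c d
  LWalk₂⇒ShareEnd² (step {x = h₁} {y = h₂} (_ , h₁h₂ , _ , ab∩h)
                        (step (_ , _ , _ , h∩vw) (here _ vw≈cd))) =
    h₁ , h₂ , h₁h₂ , ab∩h , ShareEnd-respʳ vw≈cd h∩vw

-- Extending a colouring

Colouring : ℕ → ℕ → Set
Colouring n k = Fin n → Fin n → Maybe (Label k)

Around : Graph n → Colouring n k → Fin n → (Label k → Set) → Set
Around G f v P = ∀ w → Adj G v w → All P (f v w)

record Admissible (G : Graph n) (f : Colouring n k) (a b : Fin n) (L : Label k) : Set where
  field
    near : ∀ {c d} → ShareEnd a b c d → All (Compatible 1 L) (f c d)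
    far  : ∀ {h₁ h₂ c d} → Adj G h₁ h₂ → ShareEnd a b h₁ h₂ → ShareEnd h₁ h₂ c d →
           All (Compatible 2 L) (f c d)

_[_,_]≔_ : Colouring n k → Fin n → Fin n → Label k → Colouring n k
(f [ a , b ]≔ L) c d with SameEdge? c d a b
... | yes _ = just L
... | no _ = f c d

module _ {f : Colouring n k} {L : Label k} where

  update-here : ∀ a b → (f [ a , b ]≔ L) a b ≡ just L
  update-here a b with SameEdge? a b a b
  ... | yes _ = refl
  ... | no ab≉ab = ⊥-elim (ab≉ab SameEdge-refl)

  update-other : ¬ SameEdge c d a b → (f [ a , b ]≔ L) c d ≡ f c d
  update-other {c = c} {d} {a} {b} cd≉ab with SameEdge? c d a b
  ... | yes cd≈ab = ⊥-elim (cd≉ab cd≈ab)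
  ... | no _ = refl

  update-cases : ∀ c d → SameEdge c d a b × (f [ a , b ]≔ L) c d ≡ just L
                        ⊎ ¬ SameEdge c d a b × (f [ a , b ]≔ L) c d ≡ f c d
  update-cases {a = a} {b = b} c d with SameEdge? c d a b
  ... | yes cd≈ab = inj₁ (cd≈ab , refl)
  ... | no cd≉ab = inj₂ (cd≉ab , refl)

  Admissible-update : {G : Graph n} {L′ : Label k} → Admissible G f a b L′ → common L′ L ≡ 0 →
                      Admissible G (f [ c , d ]≔ L) a b L′
  Admissible-update {c = c} {d} {L′ = L′} admissible L′∩L≡0 = record
    { near = λ {c′} {d′} ab∩ → at c′ d′ (near ab∩)
    ; far  = λ {_} {_} {c′} {d′} h₁h₂ ab∩h h∩ → at c′ d′ (far h₁h₂ ab∩h h∩)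
    }
    where
    open Admissible admissible
    at : ∀ c′ d′ → All (Compatible (suc m) L′) (f c′ d′) →
         All (Compatible (suc m) L′) ((f [ c , d ]≔ L) c′ d′)
    at c′ d′ compatible with update-cases c′ d′
    ... | inj₁ (_ , ≡L) =
      subst (All (Compatible _ L′)) (sym ≡L) (just (s≤s (subst (_≤ _) (sym L′∩L≡0) z≤n)))
    ... | inj₂ (_ , ≡f) = subst (All (Compatible _ L′)) (sym ≡f) compatible

partners : {I : Set} (C : I → Subset k) (x : Fin k) → Dec (∃ λ i → x ∈ C i) → Subset k
partners C x (yes (i , _)) = C i - x
partners C x (no _) = ∅

∣partners∣≤1 : {I : Set} {C : I → Subset k} {x : Fin k} → (∀ i → ∣ C i ∣ ≤ 2) →
               (d : Dec (∃ λ i → x ∈ C i)) → ∣ partners C x d ∣ ≤ 1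
∣partners∣≤1 ∣C∣≤2 (yes (i , x∈Ci)) = ≤-pred (≤-trans (x∈p⇒∣p-x∣<∣p∣ x∈Ci) (∣C∣≤2 i))
∣partners∣≤1 {k = k} _ (no _) = ≤-trans (≤-reflexive (∣⊥∣≡0 k)) z≤n

∉partners : {I : Set} {C : I → Subset k} {x y : Fin k} →
            (∀ {i j} → x ∈ C i → x ∈ C j → i ≡ j) → y ≢ x →
            (d : Dec (∃ λ i → x ∈ C i)) → y ∉ partners C x d → ∀ i → x ∉ C i ⊎ y ∉ C i
∉partners _ _ (no none) _ i = inj₁ (λ x∈Ci → none (i , x∈Ci))
∉partners {C = C} {x} unique y≢x (yes (j , x∈Cj)) y∉ i with x ∈? C i
... | no x∉Ci = inj₁ x∉Ci
... | yes x∈Ci with unique x∈Ci x∈Cj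
...   | refl = inj₂ (λ y∈Ci → y∉ (x∈p∧x≢y⇒x∈p-y y∈Ci y≢x))

partnersAt : Colouring n k → Fin n → Fin k → Subset k
partnersAt f v x = partners (λ w → colours (f v w)) x (any? λ w → x ∈? colours (f v w))

∣partnersAt∣≤1 : (f : Colouring n k) (v : Fin n) (x : Fin k) → ∣ partnersAt f v x ∣ ≤ 1
∣partnersAt∣≤1 f v x = ∣partners∣≤1 (λ w → ∣colours∣≤2 (f v w)) (any? λ w → x ∈? colours (f v w))

module ColouringProperties {G : Graph n} {f : Colouring n k} (f-valid : IsPartial2Tone G k f) where

  open IsPartial2Tone f-valid
  open GraphProperties G

  All-flip : {P : Label k → Set} → All P (f a b) → All P (f b a)
  All-flip {a = a} {b} = subst (All _) (symm a b)

  ∈colours-flip : {x : Fin k} → x ∈ colours (f a b) → x ∈ colours (f b a)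
  ∈colours-flip {a = a} {b} = subst (λ M → _ ∈ colours M) (symm a b)

  SameEdge⇒≡ : SameEdge a b c d → f a b ≡ f c d
  SameEdge⇒≡ (inj₁ (refl , refl)) = refl
  SameEdge⇒≡ (inj₂ (refl , refl)) = symm _ _

  all-if-edge : {P : Label k → Set} → (Adj G a b → All P (f a b)) → All P (f a b)
  all-if-edge {a = a} {b} on-edge with f a b in fab
  ... | nothing = nothing
  ... | just B = on-edge (onEdges a b B fab)

  around-touching : {P : Label k → Set} → Around G f v P → v ≡ c ⊎ v ≡ d → All P (f c d)
  around-touching around (inj₁ refl) = all-if-edge (around _)
  around-touching around (inj₂ refl) = All-flip (all-if-edge (around _))

  colours-disjoint-at : {x : Fin k} → a ≢ b → x ∈ colours (f v a) → x ∉ colours (f v b)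
  colours-disjoint-at {a = a} {b} {v} a≢b x∈A x∈B with f v a in fva | f v b in fvb
  ... | nothing | _ = ∉⊥ x∈A
  ... | just _ | nothing = ∉⊥ x∈B
  ... | just A | just B = <-irrefl refl (≤-trans (x∈p⇒0<∣p∣ (x∈p∩q⁺ (x∈A , x∈B))) (≤-pred A∩B<1))
    where
    vb : Adj G v b
    vb = onEdges v b B fvb
    va≉vb : ¬ SameEdge v a v b
    va≉vb = ¬SameEdge-at vb a≢b
    A∩B<1 : common A B < 1
    A∩B<1 = valid v a v b A B fva fvb va≉vb 1
              (step (onEdges v a A fva , vb , va≉vb , inj₁ (inj₁ refl)) (here vb SameEdge-refl))

  colour-unique-at : {x : Fin k} → x ∈ colours (f v a) → x ∈ colours (f v b) → a ≡ b
  colour-unique-at {a = a} {b = b} x∈A x∈B with a ≟ b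
  ... | yes a≡b = a≡b
  ... | no a≢b = ⊥-elim (colours-disjoint-at a≢b x∈A x∈B)

  colours-distance-two : Adj G v w → a ≢ w → v ≢ b →
                         ∣ colours (f v a) ∩ colours (f w b) ∣ ≤ 1
  colours-distance-two {v = v} {w} {a} {b} vw a≢w v≢b with f v a in fva | f w b in fwb
  ... | nothing | _ = ≤-trans (∣p∩q∣≤∣p∣ (∅ {n = k}) _) (≤-trans (≤-reflexive (∣⊥∣≡0 k)) z≤n)
  ... | just (A , _) | nothing =
    ≤-trans (∣p∩q∣≤∣q∣ A (∅ {n = k})) (≤-trans (≤-reflexive (∣⊥∣≡0 k)) z≤n)
  ... | just A | just B = ≤-pred (valid v a w b A B fva fwb ≉wb 2 walk)
    where
    wb : Adj G w b
    wb = onEdges w b B fwb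
    ≉wb : ¬ SameEdge v c w b
    ≉wb (inj₁ (v≡w , _)) = Adj⇒≢ vw v≡w
    ≉wb (inj₂ (v≡b , _)) = v≢b v≡b
    walk : LWalk G v a w b 2
    walk = step (onEdges v a A fva , vw , ¬SameEdge-at vw a≢w , inj₁ (inj₁ refl))
                (step (vw , wb , ≉wb , inj₂ (inj₁ refl)) (here wb SameEdge-refl))

  around-partners : {x y : Fin k} (x≢y : x ≢ y) → y ∉ partnersAt f v x →
                    Around G f v (Compatible 2 (pair x y x≢y))
  around-partners {v = v} {x} x≢y y∉ w _ =
    compatible₂ x≢y (∉partners colour-unique-at (≢-sym x≢y) (any? λ w → x ∈? colours (f v w)) y∉ w)

  admissible : {L : Label k} → Adj G a b →
               Around G f a (Compatible 1 L) → Around G f b (Compatible 1 L) →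
               (∀ v → Adj G a v → Around G f v (Compatible 2 L)) →
               (∀ v → Adj G b v → Around G f v (Compatible 2 L)) →
               Admissible G f a b L
  admissible {a = a} {b} {L} ab around-a around-b around-N[a] around-N[b] = record
    { near = [ around-touching around-a , around-touching around-b ]′
    ; far  = λ h₁h₂ ab∩h → let around-h₁ , around-h₂ = around-ends h₁h₂ ab∩h
                           in [ around-touching around-h₁ , around-touching around-h₂ ]′
    }
    where
    around-ends : ∀ {h₁ h₂} → Adj G h₁ h₂ → ShareEnd a b h₁ h₂ →
                  Around G f h₁ (Compatible 2 L) × Around G f h₂ (Compatible 2 L)
    around-ends h₁h₂ (inj₁ (inj₁ refl)) = around-N[b] _ (Adj-sym ab) , around-N[a] _ h₁h₂
    around-ends h₁h₂ (inj₁ (inj₂ refl)) = around-N[a] _ (Adj-sym h₁h₂) , around-N[b] _ (Adj-sym ab)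
    around-ends h₁h₂ (inj₂ (inj₁ refl)) = around-N[a] _ ab , around-N[b] _ h₁h₂
    around-ends h₁h₂ (inj₂ (inj₂ refl)) = around-N[b] _ (Adj-sym h₁h₂) , around-N[a] _ ab

  admissible-walk : {L B : Label k} → f a b ≡ nothing → Admissible G f a b L →
                    f c d ≡ just B → LWalk G a b c d m → common L B < m
  admissible-walk {m = zero} fab _ fcd walk
    with trans (sym fab) (trans (SameEdge⇒≡ (LWalk₀⇒SameEdge walk)) fcd)
  ... | ()
  admissible-walk {m = 1} _ admissible fcd walk =
    drop-just (subst (All _) fcd (Admissible.near admissible (LWalk₁⇒ShareEnd walk)))
  admissible-walk {m = 2} _ admissible fcd walk =
    let h₁ , h₂ , h₁h₂ , ab∩h , h∩cd = LWalk₂⇒ShareEnd² walk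
    in drop-just (subst (All _) fcd (Admissible.far admissible h₁h₂ ab∩h h∩cd))
  admissible-walk {m = suc (suc (suc m))} {L = L} {B} _ _ _ _ =
    <-≤-trans (s≤s (common≤2 L B)) (m≤m+n 3 m)

  extend-valid : {L : Label k} → Adj G a b → f a b ≡ nothing → Admissible G f a b L →
                 IsPartial2Tone G k (f [ a , b ]≔ L)
  extend-valid {a = a} {b} {L} ab fab admissible = record
    { onEdges = onEdges′ ; symm = symm′ ; valid = valid′ }
    where
    g : Colouring n k
    g = f [ a , b ]≔ L
    onEdges′ : ∀ c d A → g c d ≡ just A → Adj G c d
    onEdges′ c d A gcd with update-cases c d
    ... | inj₁ (cd≈ab , _) = Adj-resp cd≈ab ab
    ... | inj₂ (_ , gcd≡fcd) = onEdges c d A (trans (sym gcd≡fcd) gcd)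
    symm′ : ∀ c d → g c d ≡ g d c
    symm′ c d with update-cases c d | update-cases d c
    ... | inj₁ (_ , ≡L) | inj₁ (_ , ≡L′) = trans ≡L (sym ≡L′)
    ... | inj₁ (cd≈ab , _) | inj₂ (dc≉ab , _) = ⊥-elim (dc≉ab (SameEdge-swap cd≈ab))
    ... | inj₂ (cd≉ab , _) | inj₁ (dc≈ab , _) = ⊥-elim (cd≉ab (SameEdge-swap dc≈ab))
    ... | inj₂ (_ , ≡f) | inj₂ (_ , ≡f′) = trans ≡f (trans (symm c d) (sym ≡f′))
    valid′ : ∀ c d c′ d′ A B → g c d ≡ just A → g c′ d′ ≡ just B → ¬ SameEdge c d c′ d′ →
             ∀ m → LWalk G c d c′ d′ m → common A B < m
    valid′ c d c′ d′ A B gcd gc′d′ cd≉c′d′ m walk with update-cases c d | update-cases c′ d′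
    ... | inj₁ (cd≈ab , _) | inj₁ (c′d′≈ab , _) =
      ⊥-elim (cd≉c′d′ (SameEdge-trans cd≈ab (SameEdge-sym c′d′≈ab)))
    ... | inj₁ (cd≈ab , ≡L) | inj₂ (_ , ≡f) =
      subst (λ A → common A B < m) (just-injective (trans (sym ≡L) gcd))
        (admissible-walk fab admissible (trans (sym ≡f) gc′d′) (LWalk-resp (SameEdge-sym cd≈ab) walk))
    ... | inj₂ (_ , ≡f) | inj₁ (c′d′≈ab , ≡L) =
      subst (λ B → common A B < m) (just-injective (trans (sym ≡L) gc′d′))
        (subst (_< m) (common-comm L A)
          (admissible-walk fab admissible (trans (sym ≡f) gcd)
            (LWalk-resp (SameEdge-sym c′d′≈ab) (LWalk-reverse walk))))
    ... | inj₂ (_ , ≡f) | inj₂ (_ , ≡f′) =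
      valid c d c′ d′ A B (trans (sym ≡f) gcd) (trans (sym ≡f′) gc′d′) cd≉c′d′ m walk

record AdmissibleLabels (G : Graph n) (f : Colouring n k) (u u₁ u₂ u₃ : Fin n) : Set where
  field
    L₁ L₂ L₃ : Label k
    admissible₁ : Admissible G f u u₁ L₁
    admissible₂ : Admissible G f u u₂ L₂
    admissible₃ : Admissible G f u u₃ L₃
    L₂∩L₁≡0 : common L₂ L₁ ≡ 0
    L₂∩L₃≡0 : common L₂ L₃ ≡ 0
    L₃∩L₁≡0 : common L₃ L₁ ≡ 0

extend-star : {G : Graph n} {f : Colouring n k} {u u₁ u₂ u₃ : Fin n} → IsPartial2Tone G k f →
              Adj G u u₁ → Adj G u u₂ → Adj G u u₃ → u₁ ≢ u₂ → u₁ ≢ u₃ → u₂ ≢ u₃ →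
              f u u₁ ≡ nothing → f u u₂ ≡ nothing → f u u₃ ≡ nothing →
              AdmissibleLabels G f u u₁ u₂ u₃ →
              Σ (Colouring n k) λ g → Extends3 G k f g u u₁ u₂ u₃
extend-star {n = n} {k} {G} {f} {u} {u₁} {u₂} {u₃}
            f-valid uu₁ uu₂ uu₃ u₁≢u₂ u₁≢u₃ u₂≢u₃ f-uu₁ f-uu₂ f-uu₃ labels =
  g₃ , g₃-valid , g₃-agrees , (L₁ , g₃-uu₁) , (L₂ , g₃-uu₂) , (L₃ , g₃-uu₃)
  where
  open AdmissibleLabels labels
  open GraphProperties G using (¬SameEdge-at)
  open ColouringProperties using (extend-valid)

  g₁ g₂ g₃ : Colouring n k
  g₁ = f [ u , u₁ ]≔ L₁
  g₂ = g₁ [ u , u₂ ]≔ L₂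
  g₃ = g₂ [ u , u₃ ]≔ L₃

  g₃-valid : IsPartial2Tone G k g₃
  g₃-valid =
    extend-valid g₂-valid uu₃ (trans (update-other (¬SameEdge-at uu₂ (≢-sym u₂≢u₃)))
                                (trans (update-other (¬SameEdge-at uu₁ (≢-sym u₁≢u₃))) f-uu₃))
                 (Admissible-update (Admissible-update admissible₃ L₃∩L₁≡0)
                                    (trans (common-comm L₃ L₂) L₂∩L₃≡0))
    where
    g₁-valid : IsPartial2Tone G k g₁
    g₁-valid = extend-valid f-valid uu₁ f-uu₁ admissible₁
    g₂-valid : IsPartial2Tone G k g₂
    g₂-valid = extend-valid g₁-valid uu₂
                 (trans (update-other (¬SameEdge-at uu₁ (≢-sym u₁≢u₂))) f-uu₂)
                 (Admissible-update admissible₂ L₂∩L₁≡0)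

  g₃-agrees : ∀ c d → ¬ SameEdge c d u u₁ → ¬ SameEdge c d u u₂ → ¬ SameEdge c d u u₃ →
              g₃ c d ≡ f c d
  g₃-agrees _ _ ≉uu₁ ≉uu₂ ≉uu₃ =
    trans (update-other ≉uu₃) (trans (update-other ≉uu₂) (update-other ≉uu₁))

  g₃-uu₁ : g₃ u u₁ ≡ just L₁
  g₃-uu₁ = trans (update-other (¬SameEdge-at uu₃ u₁≢u₃))
             (trans (update-other (¬SameEdge-at uu₂ u₁≢u₂)) (update-here u u₁))

  g₃-uu₂ : g₃ u u₂ ≡ just L₂
  g₃-uu₂ = trans (update-other (¬SameEdge-at uu₃ u₂≢u₃)) (update-here u u₂)

  g₃-uu₃ : g₃ u u₃ ≡ just L₃
  g₃-uu₃ = update-here u u₃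

-- The configuration of the theorem

module Triangle
  {G : Graph n} {f : Colouring n k} (f-valid : IsPartial2Tone G k f) (9≤k : 9 ≤ k)
  {u u₁ u₂ u₃ x y : Fin n}
  (uu₁ : Adj G u u₁) (uu₂ : Adj G u u₂) (uu₃ : Adj G u u₃)
  (u₂u₁ : Adj G u₂ u₁) (u₂u₃ : Adj G u₂ u₃)
  (u₁≢u₃ : u₁ ≢ u₃) (x≢u₂ : x ≢ u₂) (y≢u₂ : y ≢ u₂)
  (N[u] : GraphProperties.NeighboursAre G u u₁ u₂ u₃)
  (N[u₁] : GraphProperties.NeighboursAre G u₁ u u₂ x)
  (N[u₂] : GraphProperties.NeighboursAre G u₂ u u₁ u₃)
  (N[u₃] : GraphProperties.NeighboursAre G u₃ u u₂ y)
  (f-uu₁ : f u u₁ ≡ nothing) (f-uu₂ : f u u₂ ≡ nothing) (f-uu₃ : f u u₃ ≡ nothing)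
  where

  open GraphProperties G
  open ColouringProperties f-valid

  P Q R S : Maybe (Label k)
  P = f u₂ u₁
  Q = f u₂ u₃
  R = f u₁ x
  S = f u₃ y

  private
    variable
      C : Label k → Set

  uncoloured : f a b ≡ nothing → All C (f a b)
  uncoloured fab = subst (All _) (sym fab) nothing

  around-u : Around G f u C
  around-u = ∀-neighbour N[u] (uncoloured f-uu₁) (uncoloured f-uu₂) (uncoloured f-uu₃)

  around-u₁ : All C P → All C R → Around G f u₁ C
  around-u₁ C-P C-R = ∀-neighbour N[u₁] (All-flip (uncoloured f-uu₁)) (All-flip C-P) C-R

  around-u₂ : All C P → All C Q → Around G f u₂ C
  around-u₂ C-P C-Q = ∀-neighbour N[u₂] (All-flip (uncoloured f-uu₂)) C-P C-Q

  around-u₃ : All C Q → All C S → Around G f u₃ C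
  around-u₃ C-Q C-S = ∀-neighbour N[u₃] (All-flip (uncoloured f-uu₃)) (All-flip C-Q) C-S

  admissible-uu₁ : {q a : Fin k} (q≢a : q ≢ a) →
                   q ∉ colours P → a ∉ colours P → q ∉ colours R → a ∉ colours R →
                   a ∉ colours Q → q ∉ colours S → a ∉ partnersAt f x q →
                   Admissible G f u u₁ (pair q a q≢a)
  admissible-uu₁ q≢a q∉P a∉P q∉R a∉R a∉Q q∉S a∉x-partners =
    admissible uu₁ around-u (around-u₁ (compatible₁ q≢a q∉P a∉P) (compatible₁ q≢a q∉R a∉R))
      (∀-neighbour N[u] (around-u₁ (compatible₂ q≢a (inj₁ q∉P)) (compatible₂ q≢a (inj₁ q∉R)))
                        around-at-u₂
                        (around-u₃ (compatible₂ q≢a (inj₂ a∉Q)) (compatible₂ q≢a (inj₁ q∉S))))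
      (∀-neighbour N[u₁] around-u around-at-u₂ (around-partners q≢a a∉x-partners))
    where
    around-at-u₂ : Around G f u₂ (Compatible 2 (pair _ _ q≢a))
    around-at-u₂ = around-u₂ (compatible₂ q≢a (inj₁ q∉P)) (compatible₂ q≢a (inj₂ a∉Q))

  admissible-uu₂ : {c e : Fin k} (c≢e : c ≢ e) →
                   c ∉ colours P → e ∉ colours P → c ∉ colours Q → e ∉ colours Q →
                   c ∉ colours R → e ∉ partnersAt f u₃ c →
                   Admissible G f u u₂ (pair c e c≢e)
  admissible-uu₂ c≢e c∉P e∉P c∉Q e∉Q c∉R e∉u₃-partners =
    admissible uu₂ around-u (around-u₂ (compatible₁ c≢e c∉P e∉P) (compatible₁ c≢e c∉Q e∉Q))
      (∀-neighbour N[u] around-at-u₁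
                        (around-u₂ (compatible₂ c≢e (inj₁ c∉P)) (compatible₂ c≢e (inj₁ c∉Q)))
                        (around-partners c≢e e∉u₃-partners))
      (∀-neighbour N[u₂] around-u around-at-u₁ (around-partners c≢e e∉u₃-partners))
    where
    around-at-u₁ : Around G f u₁ (Compatible 2 (pair _ _ c≢e))
    around-at-u₁ = around-u₁ (compatible₂ c≢e (inj₁ c∉P)) (compatible₂ c≢e (inj₁ c∉R))

  admissible-uu₃ : {p b : Fin k} (p≢b : p ≢ b) →
                   p ∉ colours Q → b ∉ colours Q → p ∉ colours S → b ∉ colours S →
                   b ∉ colours P → p ∉ colours R → b ∉ partnersAt f y p →
                   Admissible G f u u₃ (pair p b p≢b)
  admissible-uu₃ p≢b p∉Q b∉Q p∉S b∉S b∉P p∉R b∉y-partners =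
    admissible uu₃ around-u (around-u₃ (compatible₁ p≢b p∉Q b∉Q) (compatible₁ p≢b p∉S b∉S))
      (∀-neighbour N[u] (around-u₁ (compatible₂ p≢b (inj₂ b∉P)) (compatible₂ p≢b (inj₁ p∉R)))
                        around-at-u₂
                        (around-u₃ (compatible₂ p≢b (inj₁ p∉Q)) (compatible₂ p≢b (inj₁ p∉S))))
      (∀-neighbour N[u₃] around-u around-at-u₂ (around-partners p≢b b∉y-partners))
    where
    around-at-u₂ : Around G f u₂ (Compatible 2 (pair _ _ p≢b))
    around-at-u₂ = around-u₂ (compatible₂ p≢b (inj₂ b∉P)) (compatible₂ p≢b (inj₁ p∉Q))

  room : m ≤ 8 → m < k
  room m≤8 = ≤-trans (s≤s m≤8) 9≤k

  labels-from-anchors : {q p : Fin k} →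
                        q ∈ coloursOr Q q → q ∉ colours P → q ∉ colours R → q ∉ colours S →
                        p ∈ coloursOr P p → p ∉ colours Q → p ∉ colours R → p ∉ colours S → p ≢ q →
                        AdmissibleLabels G f u u₁ u₂ u₃
  labels-from-anchors {q} {p} q∈Q∪q q∉P q∉R q∉S p∈P∪p p∉Q p∉R p∉S p≢q
    with fresh (coloursOr P p ∷ coloursOr Q q ∷ colours R ∷ partnersAt f x q ∷ [])
               (∣coloursOr∣≤2 P p ∷ ∣coloursOr∣≤2 Q q ∷ ∣colours∣≤2 R ∷ ∣partnersAt∣≤1 f x q ∷ [])
               (room (n≤1+n 7))
  ... | a , a∉P∪p , a∉Q∪q , a∉R , a∉x-partners , _
    with fresh (coloursOr P p ∷ coloursOr Q q ∷ colours S ∷ ⁅ a ⁆ ∷ partnersAt f y p ∷ [])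
               (∣coloursOr∣≤2 P p ∷ ∣coloursOr∣≤2 Q q ∷ ∣colours∣≤2 S ∷ ∣⁅x⁆∣≤1 a ∷
                ∣partnersAt∣≤1 f y p ∷ [])
               (room ≤-refl)
  ... | b , b∉P∪p , b∉Q∪q , b∉S , b∉⁅a⁆ , b∉y-partners , _
    with fresh (coloursOr P p ∷ coloursOr Q q ∷ ⁅ a ⁆ ∷ ⁅ b ⁆ ∷ colours R ∷ [])
               (∣coloursOr∣≤2 P p ∷ ∣coloursOr∣≤2 Q q ∷ ∣⁅x⁆∣≤1 a ∷ ∣⁅x⁆∣≤1 b ∷ ∣colours∣≤2 R ∷ [])
               (room ≤-refl)
  ... | c , c∉P∪p , c∉Q∪q , c∉⁅a⁆ , c∉⁅b⁆ , c∉R , _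
    with fresh (coloursOr P p ∷ coloursOr Q q ∷ ⁅ a ⁆ ∷ ⁅ b ⁆ ∷ ⁅ c ⁆ ∷ partnersAt f u₃ c ∷ [])
               (∣coloursOr∣≤2 P p ∷ ∣coloursOr∣≤2 Q q ∷ ∣⁅x⁆∣≤1 a ∷ ∣⁅x⁆∣≤1 b ∷ ∣⁅x⁆∣≤1 c ∷
                ∣partnersAt∣≤1 f u₃ c ∷ [])
               (room ≤-refl)
  ... | e , e∉P∪p , e∉Q∪q , e∉⁅a⁆ , e∉⁅b⁆ , e∉⁅c⁆ , e∉u₃-partners , _ = record
    { L₁ = pair q a q≢a
    ; L₂ = pair c e c≢e
    ; L₃ = pair p b p≢b
    ; admissible₁ = admissible-uu₁ q≢a q∉P (∉P a∉P∪p) q∉R a∉R (∉Q a∉Q∪q) q∉S a∉x-partners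
    ; admissible₂ = admissible-uu₂ c≢e (∉P c∉P∪p) (∉P e∉P∪p) (∉Q c∉Q∪q) (∉Q e∉Q∪q) c∉R e∉u₃-partners
    ; admissible₃ = admissible-uu₃ p≢b p∉Q (∉Q b∉Q∪q) p∉S b∉S (∉P b∉P∪p) p∉R b∉y-partners
    ; L₂∩L₁≡0 = ∣⁅x⁆∪⁅y⁆∩q∣≡0 (∉L₁ c∉Q∪q c∉⁅a⁆) (∉L₁ e∉Q∪q e∉⁅a⁆)
    ; L₂∩L₃≡0 = ∣⁅x⁆∪⁅y⁆∩q∣≡0 (∉L₃ c∉P∪p c∉⁅b⁆) (∉L₃ e∉P∪p e∉⁅b⁆)
    ; L₃∩L₁≡0 = ∣⁅x⁆∪⁅y⁆∩q∣≡0 (∉⁅x⁆∪⁅y⁆ p≢q (∈∉⇒≢ p∈P∪p a∉P∪p)) (∉L₁ b∉Q∪q b∉⁅a⁆)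
    }
    where
    q≢a : q ≢ a
    q≢a = ∈∉⇒≢ q∈Q∪q a∉Q∪q
    p≢b : p ≢ b
    p≢b = ∈∉⇒≢ p∈P∪p b∉P∪p
    c≢e : c ≢ e
    c≢e = ≢-sym (x∉⁅y⁆⇒x≢y e∉⁅c⁆)
    ∉P : {z : Fin k} → z ∉ coloursOr P p → z ∉ colours P
    ∉P = ∉coloursOr⇒∉colours {M = P}
    ∉Q : {z : Fin k} → z ∉ coloursOr Q q → z ∉ colours Q
    ∉Q = ∉coloursOr⇒∉colours {M = Q}
    ∉L₁ : {z : Fin k} → z ∉ coloursOr Q q → z ∉ ⁅ a ⁆ → z ∉ ⁅ q ⁆ ∪ ⁅ a ⁆
    ∉L₁ = x∈p∧z∉p∧z∉⁅y⁆⇒z∉⁅x⁆∪⁅y⁆ q∈Q∪q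
    ∉L₃ : {z : Fin k} → z ∉ coloursOr P p → z ∉ ⁅ b ⁆ → z ∉ ⁅ p ⁆ ∪ ⁅ b ⁆
    ∉L₃ = x∈p∧z∉p∧z∉⁅y⁆⇒z∉⁅x⁆∪⁅y⁆ p∈P∪p

  Q-avoids : {z : Fin k} → z ∈ colours Q → Avoids z (colours P ∷ colours S ∷ [])
  Q-avoids z∈Q = colours-disjoint-at (≢-sym u₁≢u₃) z∈Q
               , colours-disjoint-at (≢-sym y≢u₂) (∈colours-flip z∈Q) , tt

  P-avoids : {q z : Fin k} → q ∉ colours P → z ∈ colours P →
             Avoids z (colours Q ∷ colours R ∷ ⁅ q ⁆ ∷ [])
  P-avoids q∉P z∈P = colours-disjoint-at u₁≢u₃ z∈P
                   , colours-disjoint-at (≢-sym x≢u₂) (∈colours-flip z∈P)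
                   , x≢y⇒x∉⁅y⁆ (∈∉⇒≢ z∈P q∉P) , tt

  admissible-labels : AdmissibleLabels G f u u₁ u₂ u₃
  admissible-labels
    with anchor Q (colours R) (colours P ∷ colours S ∷ [])
                (colours-distance-two u₂u₁ (≢-sym u₁≢u₃) (≢-sym x≢u₂)) Q-avoids
                (∣colours∣≤2 R ∷ ∣colours∣≤2 P ∷ ∣colours∣≤2 S ∷ []) (room (m≤n+m 6 2))
  ... | q , q∈Q∪q , q∉R , q∉P , q∉S , _
    with anchor P (colours S) (colours Q ∷ colours R ∷ ⁅ q ⁆ ∷ [])
                (colours-distance-two u₂u₃ u₁≢u₃ (≢-sym y≢u₂)) (P-avoids q∉P)
                (∣colours∣≤2 S ∷ ∣colours∣≤2 Q ∷ ∣colours∣≤2 R ∷ ∣⁅x⁆∣≤1 q ∷ []) (room (n≤1+n 7))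
  ... | p , p∈P∪p , p∉S , p∉Q , p∉R , p∉⁅q⁆ , _ =
    labels-from-anchors q∈Q∪q q∉P q∉R q∉S p∈P∪p p∉Q p∉R p∉S (x∉⁅y⁆⇒x≢y p∉⁅q⁆)

module _ {G : Graph n} (cubic : Cubic G) where

  open GraphProperties G

  cubic-triangle-labels : {f : Colouring n k} → IsPartial2Tone G k f → 9 ≤ k →
                          {u u₁ u₂ u₃ : Fin n} →
                          Adj G u u₁ → Adj G u u₂ → Adj G u u₃ → u₁ ≢ u₂ → u₁ ≢ u₃ → u₂ ≢ u₃ →
                          Adj G u₂ u₁ → Adj G u₂ u₃ →
                          f u u₁ ≡ nothing → f u u₂ ≡ nothing → f u u₃ ≡ nothing →
                          AdmissibleLabels G f u u₁ u₂ u₃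
  cubic-triangle-labels f-valid 9≤k {u} {u₁} {u₂} {u₃}
                        uu₁ uu₂ uu₃ u₁≢u₂ u₁≢u₃ u₂≢u₃ u₂u₁ u₂u₃ f-uu₁ f-uu₂ f-uu₃
    with cubic-third-neighbour (cubic u₁) (Adj-sym uu₁) (Adj-sym u₂u₁) (Adj⇒≢ uu₂)
       | cubic-third-neighbour (cubic u₃) (Adj-sym uu₃) (Adj-sym u₂u₃) (Adj⇒≢ uu₂)
  ... | x , _ , _ , x≢u₂ , N[u₁] | y , _ , _ , y≢u₂ , N[u₃] =
    Triangle.admissible-labels f-valid 9≤k uu₁ uu₂ uu₃ u₂u₁ u₂u₃ u₁≢u₃ x≢u₂ y≢u₂
                    N[u] N[u₁] N[u₂] N[u₃] f-uu₁ f-uu₂ f-uu₃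
    where
    N[u] : NeighboursAre u u₁ u₂ u₃
    N[u] = cubic-neighbours (cubic u) uu₁ uu₂ uu₃ u₁≢u₂ u₁≢u₃ u₂≢u₃
    N[u₂] : NeighboursAre u₂ u u₁ u₃
    N[u₂] = cubic-neighbours (cubic u₂) (Adj-sym uu₂) u₂u₁ u₂u₃ (Adj⇒≢ uu₁) (Adj⇒≢ uu₃) u₁≢u₃

mainTheorem13 : {n : ℕ} (G : Graph n) → Cubic G →
    (f : Fin n → Fin n → Maybe (Label 9)) → IsPartial2Tone G 9 f →
    (u u₁ u₂ u₃ : Fin n) →
    Adj G u u₁ → Adj G u u₂ → Adj G u u₃ →
    ¬ u₁ ≡ u₂ → ¬ u₁ ≡ u₃ → ¬ u₂ ≡ u₃ →
    Adj G u₂ u₁ → Adj G u₂ u₃ →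
    f u u₁ ≡ nothing → f u u₂ ≡ nothing → f u u₃ ≡ nothing →
    Σ (Fin n → Fin n → Maybe (Label 9)) (λ g → Extends3 G 9 f g u u₁ u₂ u₃)
mainTheorem13 G cubic f f-valid u u₁ u₂ u₃
              uu₁ uu₂ uu₃ u₁≢u₂ u₁≢u₃ u₂≢u₃ u₂u₁ u₂u₃ f-uu₁ f-uu₂ f-uu₃ =
  extend-star f-valid uu₁ uu₂ uu₃ u₁≢u₂ u₁≢u₃ u₂≢u₃ f-uu₁ f-uu₂ f-uu₃
    (cubic-triangle-labels cubic f-valid ≤-refl
                           uu₁ uu₂ uu₃ u₁≢u₂ u₁≢u₃ u₂≢u₃ u₂u₁ u₂u₃ f-uu₁ f-uu₂ f-uu₃)
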